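{- Let $s,t\ge2$. Let $X$ and $Y$ be the multisets of rows of two disjoint $\mathrm{OA}(\ell,r,s,t)_\lambda$ (on the same set of $s$ distinct rational symbols). Then $(X,Y)$ is a proper $\mathrm{PTE}_r$ solution of degree $t$ and size $\ell$.
   Context: An orthogonal array $\mathrm{OA}(\ell,r,s,t)_\lambda$ of strength $t$, index $\lambda$ and $s$ levels is an $\ell\times r$ array with entries from a set of $s$ symbols (here distinct rational numbers) such that in every $\ell\times t$ subarray, each of the $s^t$ ordered $t$-tuples of symbols occurs as a row exactly $\lambda$ times. Two such arrays are disjoint if they have no row in common. For multisets $A=\{\mathbf{a}_1,\ldots,\mathbf{a}_n\}$, $B=\{\mathbf{b}_1,\ldots,\mathbf{b}_n\}\subset\mathbb{Q}^r$, $\mathbf{a}_i=(a_{i1},\ldots,a_{ir})$, $\mathbf{b}_i=(b_{i1},\ldots,b_{ir})$, $(A,B)$ is a $\mathrm{PTE}_r$ solution of degree $m$ and size $n$ if $A,B$ have no common element and $\sum_i\prod_j a_{ij}^{k_j}=\sum_i\prod_j b_{ij}^{k_j}$ for all nonnegative integers $k_j$ with $1\le\sum_jk_j\le m$; it is proper if the $n\times r$ matrices with rows $\mathbf{a}_i$ resp. $\mathbf{b}_i$ both have rank $r$. -}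

module Defs where

open import Data.Nat using (ℕ; zero; suc; _≤_)
import Data.Nat as ℕ
open import Data.Fin using (Fin; zero; suc)
open import Data.Fin.Properties using (all?)
open import Data.Rational using (ℚ; 0ℚ; 1ℚ; _+_; _*_)
open import Data.Rational.Properties using (_≟_)
open import Data.Product using (Σ; _×_)
open import Function.Definitions using (Injective)
open import Relation.Binary.PropositionalEquality using (_≡_)
open import Relation.Nullary using (¬_; does)
open import Data.Bool using (if_then_else_)

sumℚ : ∀ {n} → (Fin n → ℚ) → ℚ
sumℚ {zero} f = 0ℚ
sumℚ {suc n} f = f zero + sumℚ (λ i → f (suc i))

prodℚ : ∀ {n} → (Fin n → ℚ) → ℚ
prodℚ {zero} f = 1ℚ
prodℚ {suc n} f = f zero * prodℚ (λ i → f (suc i))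

sumℕ : ∀ {n} → (Fin n → ℕ) → ℕ
sumℕ {zero} f = 0
sumℕ {suc n} f = f zero ℕ.+ sumℕ (λ i → f (suc i))

_^_ : ℚ → ℕ → ℚ
x ^ zero = 1ℚ
x ^ suc k = x * (x ^ k)

Array : ℕ → ℕ → Set
Array ℓ r = Fin ℓ → Fin r → ℚ

countRows : ∀ {ℓ r t} → Array ℓ r → (Fin t → Fin r) → (Fin t → ℚ) → ℕ
countRows {zero} A c v = 0
countRows {suc ℓ} A c v =
  (if does (all? (λ k → A zero (c k) ≟ v k)) then 1 else 0)
  ℕ.+ countRows (λ i → A (suc i)) c v

record IsOA (ℓ r s t λ′ : ℕ) (S : Fin s → ℚ) (A : Array ℓ r) : Set where
  field
    symbolsDistinct : Injective _≡_ _≡_ S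
    t≤r : t ≤ r
    entriesSymbols : ∀ i j → Σ (Fin s) (λ a → A i j ≡ S a)
    balanced : ∀ (c : Fin t → Fin r) → Injective _≡_ _≡_ c →
               ∀ (u : Fin t → Fin s) → countRows A c (λ k → S (u k)) ≡ λ′

SameRow : ∀ {r} → (Fin r → ℚ) → (Fin r → ℚ) → Set
SameRow a b = ∀ j → a j ≡ b j

Disjoint : ∀ {ℓ ℓ′ r} → Array ℓ r → Array ℓ′ r → Set
Disjoint A B = ∀ i i′ → ¬ SameRow (A i) (B i′)

monomial : ∀ {r} → (Fin r → ℚ) → (Fin r → ℕ) → ℚ
monomial a k = prodℚ (λ j → a j ^ k j)

HasRank : ∀ {n r} → Array n r → Set
HasRank {n} {r} M = ∀ (c : Fin r → ℚ) → (∀ i → sumℚ (λ j → c j * M i j) ≡ 0ℚ) → ∀ j → c j ≡ 0ℚ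

-- (A, B) is a PTE_r solution of degree m and size n (multisets given as indexed families)
IsPTE : ∀ {n r} → ℕ → Array n r → Array n r → Set
IsPTE {n} {r} m A B =
  Disjoint A B ×
  (∀ (k : Fin r → ℕ) → 1 ≤ sumℕ k → sumℕ k ≤ m →
     sumℚ (λ i → monomial (A i) k) ≡ sumℚ (λ i → monomial (B i) k))

IsProperPTE : ∀ {n r} → ℕ → Array n r → Array n r → Set
IsProperPTE m A B = IsPTE m A B × HasRank A × HasRank B

{-# OPTIONS --safe #-}
-- If f is a function of a row that looks only at t of the columns, then f has the same sum
-- over the rows of any two OA(ℓ, r, s, t)_λ on the same symbols: restricted to t distinct
-- columns containing those f looks at, both arrays contain each t-tuple of symbols exactly λ
-- times and nothing else, so the restricted rows form the same multiset. Monomials of degree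
-- at most t are such functions, which gives the PTE equations.
--
-- For the rank, let γ annihilate every row of an OA X, fix a column j and two symbols a ≠ b.
-- Swapping a and b in column j turns X into another OA, so (as t ≥ 2) the rows of X with a in
-- column j and those with b there are equally many, N > 0, and have the same sum outside
-- column j. Pairing both row sums with γ leaves γ_j a N = γ_j b N, hence γ_j = 0.
module Submission where

open import Defs
open import Data.Nat using (ℕ; _≤_)
open import Data.Fin using (Fin)
open import Data.Rational using (ℚ)

open import Algebra.Bundles using (Ring; CommutativeMonoid)
import Algebra.Properties.CommutativeMonoid.Sum as CommutativeMonoidSum
import Algebra.Properties.CommutativeSemigroup as CommutativeSemigroupProperties
import Algebra.Properties.Semiring.Sum as SemiringSum
open import Data.Bool using (if_then_else_)
open import Data.Fin using (zero; suc; punchIn)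
open import Data.Fin.Properties using (all?; suc-injective; punchInᵢ≢i)
import Data.Fin.Properties as Fin
open import Data.Nat using (zero; suc; _+_; z≤n; s≤s)
import Data.Nat.Properties as ℕ
open import Data.Product using (∃; _×_; _,_; proj₁; proj₂)
open import Data.Rational using (0ℚ; 1ℚ; _*_; _<_; ≢-nonZero; 1/_)
import Data.Rational as ℚ
open import Data.Rational.Properties using (_≟_)
import Data.Rational.Properties as ℚ
open import Data.Sum using (inj₁; inj₂)
open import Data.Vec.Functional using (removeAt; _∷_)
open import Function using (id; _∘_)
open import Function.Bundles using (_⇔_; mk⇔)
open import Function.Definitions using (Injective)
open import Relation.Binary.PropositionalEquality
open import Algebra.Definitions (_≡_ {A = ℚ}) using (Involutive; AlmostLeftCancellative)
open import Relation.Nullary using (Dec; yes; no; does; ¬_; contradiction)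
open import Relation.Nullary.Decidable using (does-⇔; dec-true; dec-false)

open SemiringSum (Ring.semiring ℚ.+-*-ring) using (sum; sum-remove; ∑-comm; *-distribˡ-sum)
open CommutativeMonoidSum ℕ.+-0-commutativeMonoid using () renaming (sum to sumᴺ; ∑-distrib-+ to ∑ᴺ-distrib-+)
open CommutativeSemigroupProperties ℕ.+-commutativeSemigroup using () renaming (x∙yz≈y∙xz to +-left-comm)
open CommutativeSemigroupProperties (CommutativeMonoid.commutativeSemigroup ℚ.*-1-commutativeMonoid)
  using () renaming (x∙yz≈y∙xz to *-left-comm)
open import Algebra.Properties.Group ℚ.+-0-group using () renaming (∙-cancelʳ to +-cancelʳ)

sumℚ≡sum : ∀ {n} (f : Fin n → ℚ) → sumℚ f ≡ sum f
sumℚ≡sum {zero} f = refl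
sumℚ≡sum {suc n} f = cong (f zero ℚ.+_) (sumℚ≡sum (f ∘ suc))

sumℕ≡sum : ∀ {n} (f : Fin n → ℕ) → sumℕ f ≡ sumᴺ f
sumℕ≡sum {zero} f = refl
sumℕ≡sum {suc n} f = cong (f zero +_) (sumℕ≡sum (f ∘ suc))

sumℚ-cong : ∀ {n} {f g : Fin n → ℚ} → (∀ i → f i ≡ g i) → sumℚ f ≡ sumℚ g
sumℚ-cong {zero} _ = refl
sumℚ-cong {suc n} f≗g = cong₂ ℚ._+_ (f≗g zero) (sumℚ-cong (f≗g ∘ suc))

sumℚ-zero : ∀ n → sumℚ {n} (λ _ → 0ℚ) ≡ 0ℚ
sumℚ-zero zero = refl
sumℚ-zero (suc n) = cong (0ℚ ℚ.+_) (sumℚ-zero n)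

sumℚ-remove : ∀ {n} (f : Fin (suc n) → ℚ) p → sumℚ f ≡ f p ℚ.+ sumℚ (removeAt f p)
sumℚ-remove f p = begin
  sumℚ f                          ≡⟨ sumℚ≡sum f ⟩
  sum f                           ≡⟨ sum-remove f ⟩
  f p ℚ.+ sum (removeAt f p)      ≡⟨ cong (f p ℚ.+_) (sumℚ≡sum (removeAt f p)) ⟨
  f p ℚ.+ sumℚ (removeAt f p)     ∎
  where open ≡-Reasoning

*-distribˡ-sumℚ : ∀ {n} x (f : Fin n → ℚ) → x * sumℚ f ≡ sumℚ (λ i → x * f i)
*-distribˡ-sumℚ x f = begin
  x * sumℚ f                ≡⟨ cong (x *_) (sumℚ≡sum f) ⟩
  x * sum f                 ≡⟨ *-distribˡ-sum x f ⟩
  sum (λ i → x * f i)       ≡⟨ sumℚ≡sum (λ i → x * f i) ⟨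
  sumℚ (λ i → x * f i)      ∎
  where open ≡-Reasoning

sumℚ-comm : ∀ {m n} (f : Fin m → Fin n → ℚ) →
  sumℚ (λ i → sumℚ (f i)) ≡ sumℚ (λ j → sumℚ (λ i → f i j))
sumℚ-comm f = begin
  sumℚ (λ i → sumℚ (f i))            ≡⟨ trans (sumℚ-cong (sumℚ≡sum ∘ f)) (sumℚ≡sum (sum ∘ f)) ⟩
  sum (λ i → sum (f i))              ≡⟨ ∑-comm f ⟩
  sum (λ j → sum (λ i → f i j))      ≡⟨ trans (sumℚ-cong (λ j → sumℚ≡sum (λ i → f i j)))
                                              (sumℚ≡sum (λ j → sum (λ i → f i j))) ⟨
  sumℚ (λ j → sumℚ (λ i → f i j))    ∎
  where open ≡-Reasoning

sumℚ-nonneg : ∀ {n} (f : Fin n → ℚ) → (∀ i → 0ℚ ℚ.≤ f i) → 0ℚ ℚ.≤ sumℚ f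
sumℚ-nonneg {zero} f _ = ℚ.≤-refl
sumℚ-nonneg {suc n} f f≥0 = ℚ.+-mono-≤ (f≥0 zero) (sumℚ-nonneg (f ∘ suc) (f≥0 ∘ suc))

sumℚ-pos : ∀ {n} (f : Fin n → ℚ) → (∀ i → 0ℚ ℚ.≤ f i) → ∀ p → 0ℚ < f p → 0ℚ < sumℚ f
sumℚ-pos {suc n} f f≥0 p fp>0 = subst (0ℚ <_) (sym (sumℚ-remove f p))
  (ℚ.+-mono-<-≤ fp>0 (sumℚ-nonneg (removeAt f p) (f≥0 ∘ removeAt id p)))

prodℚ-cong : ∀ {n} {f g : Fin n → ℚ} → (∀ i → f i ≡ g i) → prodℚ f ≡ prodℚ g
prodℚ-cong {zero} _ = refl
prodℚ-cong {suc n} f≗g = cong₂ _*_ (f≗g zero) (prodℚ-cong (f≗g ∘ suc))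

*-almostCancelˡ : AlmostLeftCancellative 0ℚ _*_
*-almostCancelˡ x y z x≢0 xy≡xz = begin
  y                  ≡⟨ ℚ.*-identityˡ y ⟨
  1ℚ * y             ≡⟨ cong (_* y) (ℚ.*-inverseˡ x) ⟨
  1/ x * x * y       ≡⟨ ℚ.*-assoc (1/ x) x y ⟩
  1/ x * (x * y)     ≡⟨ cong (1/ x *_) xy≡xz ⟩
  1/ x * (x * z)     ≡⟨ ℚ.*-assoc (1/ x) x z ⟨
  1/ x * x * z       ≡⟨ cong (_* z) (ℚ.*-inverseˡ x) ⟩
  1ℚ * z             ≡⟨ ℚ.*-identityˡ z ⟩
  z                  ∎
  where
  open ≡-Reasoning
  instance _ = ≢-nonZero x≢0

𝟙ℕ : ∀ {P : Set} → Dec P → ℕ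
𝟙ℕ d = if does d then 1 else 0

𝟙ℕ-⇔ : ∀ {P Q : Set} → P ⇔ Q → (d : Dec P) (e : Dec Q) → 𝟙ℕ d ≡ 𝟙ℕ e
𝟙ℕ-⇔ P⇔Q d e = cong (if_then 1 else 0) (does-⇔ P⇔Q d e)

𝟙ℕ-true : ∀ {P : Set} (d : Dec P) → P → 𝟙ℕ d ≡ 1
𝟙ℕ-true d p = cong (if_then 1 else 0) (dec-true d p)

𝟙ℕ-false : ∀ {P : Set} (d : Dec P) → ¬ P → 𝟙ℕ d ≡ 0
𝟙ℕ-false d ¬p = cong (if_then 1 else 0) (dec-false d ¬p)

𝟙ℚ : ∀ {P : Set} → Dec P → ℚ
𝟙ℚ d = if does d then 1ℚ else 0ℚ

𝟙ℚ-⇔ : ∀ {P Q : Set} → P ⇔ Q → (d : Dec P) (e : Dec Q) → 𝟙ℚ d ≡ 𝟙ℚ e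
𝟙ℚ-⇔ P⇔Q d e = cong (if_then 1ℚ else 0ℚ) (does-⇔ P⇔Q d e)

𝟙ℚ-true : ∀ {P : Set} (d : Dec P) → P → 𝟙ℚ d ≡ 1ℚ
𝟙ℚ-true d p = cong (if_then 1ℚ else 0ℚ) (dec-true d p)

𝟙ℚ-nonneg : ∀ {P : Set} (d : Dec P) → 0ℚ ℚ.≤ 𝟙ℚ d
𝟙ℚ-nonneg (yes _) = ℚ.nonNegative⁻¹ 1ℚ
𝟙ℚ-nonneg (no _)  = ℚ.≤-refl

δ : ∀ {r} → Fin r → Fin r → ℕ
δ j x = 𝟙ℕ (x Fin.≟ j)

δ-diag : ∀ {r} (j : Fin r) → δ j j ≡ 1
δ-diag j = 𝟙ℕ-true (j Fin.≟ j) refl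

sumℕ-const-0 : ∀ n → sumℕ {n} (λ _ → 0) ≡ 0
sumℕ-const-0 zero = refl
sumℕ-const-0 (suc n) = sumℕ-const-0 n

sumℕ-δ : ∀ {r} (j : Fin r) → sumℕ (δ j) ≡ 1
sumℕ-δ {suc r} zero = cong suc (sumℕ-const-0 r)
sumℕ-δ {suc r} (suc j) = sumℕ-δ j

sumℕ-+ : ∀ {n} (f g : Fin n → ℕ) → sumℕ (λ i → f i + g i) ≡ sumℕ f + sumℕ g
sumℕ-+ f g = begin
  sumℕ (λ i → f i + g i)     ≡⟨ sumℕ≡sum (λ i → f i + g i) ⟩
  sumᴺ (λ i → f i + g i)     ≡⟨ ∑ᴺ-distrib-+ f g ⟩
  sumᴺ f + sumᴺ g            ≡⟨ cong₂ _+_ (sumℕ≡sum f) (sumℕ≡sum g) ⟨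
  sumℕ f + sumℕ g            ∎
  where open ≡-Reasoning

Matches : ∀ {r t} → (Fin r → ℚ) → (Fin t → Fin r) → (Fin t → ℚ) → Set
Matches a c v = ∀ m → a (c m) ≡ v m

matches? : ∀ {r t} (a : Fin r → ℚ) c (v : Fin t → ℚ) → Dec (Matches a c v)
matches? a c v = all? (λ m → a (c m) ≟ v m)

countRows-cong : ∀ {ℓ r r′ t} {X : Array ℓ r} {Y : Array ℓ r′} {c c′} {v w : Fin t → ℚ} →
  (∀ i → Matches (X i) c v ⇔ Matches (Y i) c′ w) → countRows X c v ≡ countRows Y c′ w
countRows-cong {zero} _ = refl
countRows-cong {suc ℓ} {X = X} {Y} {c} {c′} {v} {w} X⇔Y =
  cong₂ _+_ (𝟙ℕ-⇔ (X⇔Y zero) (matches? (X zero) c v) (matches? (Y zero) c′ w))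
            (countRows-cong (X⇔Y ∘ suc))

countRows-remove : ∀ {ℓ r t} (X : Array (suc ℓ) r) c (v : Fin t → ℚ) p →
  countRows X c v ≡ 𝟙ℕ (matches? (X p) c v) + countRows (removeAt X p) c v
countRows-remove X c v zero = refl
countRows-remove {suc ℓ} X c v (suc p) = trans
  (cong (𝟙ℕ (matches? (X zero) c v) +_) (countRows-remove (X ∘ suc) c v p))
  (+-left-comm (𝟙ℕ (matches? (X zero) c v)) (𝟙ℕ (matches? (X (suc p)) c v)) _)

countRows≢0⇒matches : ∀ {ℓ r t} (X : Array ℓ r) c (v : Fin t → ℚ) →
  countRows X c v ≢ 0 → ∃ λ i → Matches (X i) c v
countRows≢0⇒matches {zero} X c v n≢0 = contradiction refl n≢0
countRows≢0⇒matches {suc ℓ} X c v n≢0 with matches? (X zero) c v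
... | yes m = zero , m
... | no ¬m = let (i , m) = countRows≢0⇒matches (X ∘ suc) c v tail≢0 in suc i , m
  where
  tail≢0 : countRows (X ∘ suc) c v ≢ 0
  tail≢0 e = n≢0 (cong₂ _+_ (𝟙ℕ-false (matches? (X zero) c v) ¬m) e)

DependsOn : ∀ {r t} → (Fin t → Fin r) → ((Fin r → ℚ) → ℚ) → Set
DependsOn c f = ∀ {a b} → Matches a c (b ∘ c) → f a ≡ f b

sumℚ-cong-countRows : ∀ {n r t} (X Y : Array n r) (c : Fin t → Fin r) →
  (∀ v → countRows X c v ≡ countRows Y c v) →
  ∀ {f} → DependsOn c f → sumℚ (f ∘ X) ≡ sumℚ (f ∘ Y)
sumℚ-cong-countRows {zero} _ _ _ _ _ = refl
sumℚ-cong-countRows {suc n} X Y c sameCounts {f} f-dep = begin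
  f (X zero) ℚ.+ sumℚ (f ∘ X ∘ suc)     ≡⟨ cong₂ ℚ._+_ (f-dep X₀≈Yₚ)
                                               (sumℚ-cong-countRows (X ∘ suc) (removeAt Y p) c sameCounts′ {f} f-dep) ⟩
  f (Y p) ℚ.+ sumℚ (f ∘ removeAt Y p)   ≡⟨ sumℚ-remove (f ∘ Y) p ⟨
  sumℚ (f ∘ Y)                          ∎
  where
  open ≡-Reasoning
  X₀ = λ m → X zero (c m)
  X₀-counted : countRows X c X₀ ≢ 0
  X₀-counted e = ℕ.1+n≢0 (trans (cong (_+ countRows (X ∘ suc) c X₀) X₀-matches) e)
    where X₀-matches = sym (𝟙ℕ-true (matches? (X zero) c X₀) (λ _ → refl))
  Yₚ-hit = countRows≢0⇒matches Y c X₀ (X₀-counted ∘ trans (sameCounts X₀))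
  p = proj₁ Yₚ-hit
  X₀≈Yₚ : Matches (X zero) c (Y p ∘ c)
  X₀≈Yₚ m = sym (proj₂ Yₚ-hit m)
  sameCounts′ : ∀ v → countRows (X ∘ suc) c v ≡ countRows (removeAt Y p) c v
  sameCounts′ v = ℕ.+-cancelˡ-≡ (𝟙ℕ (matches? (X zero) c v)) (countRows (X ∘ suc) c v) rest (begin
    countRows X c v                                      ≡⟨ sameCounts v ⟩
    countRows Y c v                                      ≡⟨ countRows-remove Y c v p ⟩
    𝟙ℕ (matches? (Y p) c v) + rest                       ≡⟨ cong (_+ rest) (𝟙ℕ-⇔ same-row (matches? (Y p) c v) (matches? (X zero) c v)) ⟩
    𝟙ℕ (matches? (X zero) c v) + rest                    ∎)
    where
    rest = countRows (removeAt Y p) c v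
    same-row : Matches (Y p) c v ⇔ Matches (X zero) c v
    same-row = mk⇔ (λ h m → trans (X₀≈Yₚ m) (h m)) (λ h m → trans (sym (X₀≈Yₚ m)) (h m))

Symbolic : ∀ {s t} → (Fin s → ℚ) → (Fin t → ℚ) → Set
Symbolic S v = ∀ m → ∃ λ u → v m ≡ S u

module _ {ℓ r s t λ′} {S : Fin s → ℚ} {X : Array ℓ r} (oa : IsOA ℓ r s t λ′ S X) where
  open IsOA oa

  countRows-symbolic : ∀ {c} → Injective _≡_ _≡_ c → ∀ {v} → Symbolic S v → countRows X c v ≡ λ′
  countRows-symbolic {c} c-inj {v} v-sym = trans (countRows-cong same-rows) (balanced c c-inj (proj₁ ∘ v-sym))
    where
    same-rows : ∀ i → Matches (X i) c v ⇔ Matches (X i) c (S ∘ proj₁ ∘ v-sym)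
    same-rows i = mk⇔ (λ h m → trans (h m) (proj₂ (v-sym m))) (λ h m → trans (h m) (sym (proj₂ (v-sym m))))

  countRows≢0⇒symbolic : ∀ {n} (c : Fin n → Fin r) {v} → countRows X c v ≢ 0 → Symbolic S v
  countRows≢0⇒symbolic c {v} n≢0 m =
    let (i , hit) = countRows≢0⇒matches X c v n≢0
        (u , e) = entriesSymbols i (c m)
    in u , trans (sym (hit m)) e

countRows-OA : ∀ {ℓ r s t λ′} {S : Fin s → ℚ} {X Y : Array ℓ r} →
  IsOA ℓ r s t λ′ S X → IsOA ℓ r s t λ′ S Y →
  ∀ {c} → Injective _≡_ _≡_ c → ∀ v → countRows X c v ≡ countRows Y c v
countRows-OA {S = S} {X} {Y} oaX oaY {c} c-inj v =
  by-cases (countRows X c v ℕ.≟ 0) (countRows Y c v ℕ.≟ 0)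
  where
  both-λ′ : Symbolic S v → countRows X c v ≡ countRows Y c v
  both-λ′ v-sym = trans (countRows-symbolic oaX c-inj v-sym) (sym (countRows-symbolic oaY c-inj v-sym))
  by-cases : Dec (countRows X c v ≡ 0) → Dec (countRows Y c v ≡ 0) → countRows X c v ≡ countRows Y c v
  by-cases (yes X≡0) (yes Y≡0) = trans X≡0 (sym Y≡0)
  by-cases (no X≢0)  _         = both-λ′ (countRows≢0⇒symbolic oaX c X≢0)
  by-cases (yes _)   (no Y≢0)  = both-λ′ (countRows≢0⇒symbolic oaY c Y≢0)

Covers : ∀ {r t} → (Fin t → Fin r) → (Fin r → ℕ) → Set
Covers c k = ∀ j → k j ≢ 0 → ∃ λ m → c m ≡ j

cover : ∀ {r t} → t ≤ r → (k : Fin r → ℕ) → sumℕ k ≤ t →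
  ∃ λ (c : Fin t → Fin r) → Injective _≡_ _≡_ c × Covers c k
cover {zero} z≤n k _ = (λ ()) , (λ { {()} }) , (λ ())
cover {suc r} {t} t≤1+r k Σk≤t with k zero in k₀≡x
... | zero with ℕ.m≤n⇒m<n∨m≡n t≤1+r
...   | inj₂ refl = id , id , λ j _ → j , refl
...   | inj₁ (s≤s t≤r) =
  let (c , c-inj , c-covers) = cover t≤r (k ∘ suc) Σk≤t
  in suc ∘ c , c-inj ∘ suc-injective , covers c c-covers
  where
  covers : ∀ c → Covers c (k ∘ suc) → Covers (suc ∘ c) k
  covers c c-covers zero k₀≢0 = contradiction k₀≡x k₀≢0
  covers c c-covers (suc j) kj≢0 = let (m , e) = c-covers j kj≢0 in m , cong suc e
cover {suc r} {suc t} (s≤s t≤r) k (s≤s Σk≤t) | suc x =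
  let (c , c-inj , c-covers) = cover t≤r (k ∘ suc) (ℕ.m+n≤o⇒n≤o x Σk≤t)
  in zero ∷ suc ∘ c , ∷-inj c-inj , covers c c-covers
  where
  ∷-inj : ∀ {c : Fin t → Fin r} → Injective _≡_ _≡_ c → Injective _≡_ _≡_ (zero ∷ suc ∘ c)
  ∷-inj c-inj {zero}  {zero}  _ = refl
  ∷-inj c-inj {suc m} {suc n} e = cong suc (c-inj (suc-injective e))
  covers : ∀ c → Covers c (k ∘ suc) → Covers (zero ∷ suc ∘ c) k
  covers c c-covers zero _ = zero , refl
  covers c c-covers (suc j) kj≢0 = let (m , e) = c-covers j kj≢0 in suc m , cong suc e

DependsOnly : ∀ {r} → (Fin r → ℕ) → ((Fin r → ℚ) → ℚ) → Set
DependsOnly k f = ∀ {a b} → (∀ j → k j ≢ 0 → a j ≡ b j) → f a ≡ f b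

module _ {ℓ r s t λ′} {S : Fin s → ℚ} {X Y : Array ℓ r}
         (oaX : IsOA ℓ r s t λ′ S X) (oaY : IsOA ℓ r s t λ′ S Y) where

  sumℚ-OA-invariant : ∀ k → sumℕ k ≤ t → ∀ {f} → DependsOnly k f → sumℚ (f ∘ X) ≡ sumℚ (f ∘ Y)
  sumℚ-OA-invariant k Σk≤t {f} f-dep =
    sumℚ-cong-countRows X Y c (countRows-OA oaX oaY c-inj) {f} (λ a≈b → f-dep (covered a≈b))
    where
    c-cover = cover (IsOA.t≤r oaX) k Σk≤t
    c = proj₁ c-cover
    c-inj = proj₁ (proj₂ c-cover)
    covered : ∀ {a b} → Matches a c (b ∘ c) → ∀ j → k j ≢ 0 → a j ≡ b j
    covered {a} {b} a≈b j kj≢0 = let (m , cm≡j) = proj₂ (proj₂ c-cover) j kj≢0 in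
      subst (λ j → a j ≡ b j) cm≡j (a≈b m)

  sumℚ-OA-invariant₂ : 2 ≤ t → ∀ j j′ {f} → (∀ {a b} → a j ≡ b j → a j′ ≡ b j′ → f a ≡ f b) →
    sumℚ (f ∘ X) ≡ sumℚ (f ∘ Y)
  sumℚ-OA-invariant₂ 2≤t j j′ {f} f-dep = sumℚ-OA-invariant k Σk≤t {f}
    (λ a≈b → f-dep (a≈b j kj≢0) (a≈b j′ kj′≢0))
    where
    k = λ x → δ j x + δ j′ x
    Σk≤t : sumℕ k ≤ t
    Σk≤t = subst (_≤ t) (sym (trans (sumℕ-+ (δ j) (δ j′)) (cong₂ _+_ (sumℕ-δ j) (sumℕ-δ j′)))) 2≤t
    kj≢0 : k j ≢ 0
    kj≢0 e = ℕ.1+n≢0 (trans (sym (δ-diag j)) (ℕ.m+n≡0⇒m≡0 (δ j j) e))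
    kj′≢0 : k j′ ≢ 0
    kj′≢0 e = ℕ.1+n≢0 (trans (sym (δ-diag j′)) (ℕ.m+n≡0⇒n≡0 (δ j j′) e))

monomial-dependsOnly : ∀ {r} (k : Fin r → ℕ) → DependsOnly k (λ a → monomial a k)
monomial-dependsOnly k {a} {b} a≈b = prodℚ-cong power
  where
  power : ∀ j → a j ^ k j ≡ b j ^ k j
  power j with k j ℕ.≟ 0
  ... | yes kj≡0 = trans (cong (a j ^_) kj≡0) (cong (b j ^_) (sym kj≡0))
  ... | no kj≢0  = cong (_^ k j) (a≈b j kj≢0)

OA-moments : ∀ {ℓ r s t λ′} {S : Fin s → ℚ} {X Y : Array ℓ r} →
  IsOA ℓ r s t λ′ S X → IsOA ℓ r s t λ′ S Y →
  ∀ k → sumℕ k ≤ t → sumℚ (λ i → monomial (X i) k) ≡ sumℚ (λ i → monomial (Y i) k)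
OA-moments oaX oaY k Σk≤t = sumℚ-OA-invariant oaX oaY k Σk≤t (monomial-dependsOnly k)

OA-symbol-occurs : ∀ {ℓ r s t λ′} {S : Fin s → ℚ} {X : Array ℓ r} → IsOA ℓ r s t λ′ S X →
  1 ≤ t → 1 ≤ λ′ → ∀ j u → ∃ λ i → X i j ≡ S u
OA-symbol-occurs {t = t} {λ′} {S} {X} oa 1≤t 1≤λ′ j u =
  let (i , hit) = countRows≢0⇒matches X c (λ _ → S u) count≢0 in
  i , subst (λ j → X i j ≡ S u) cm≡j (hit m)
  where
  c-cover = cover (IsOA.t≤r oa) (δ j) (subst (_≤ t) (sym (sumℕ-δ j)) 1≤t)
  c = proj₁ c-cover
  c-hit = proj₂ (proj₂ c-cover) j (λ e → ℕ.1+n≢0 (trans (sym (δ-diag j)) e))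
  m = proj₁ c-hit
  cm≡j = proj₂ c-hit
  count≢0 : countRows X c (λ _ → S u) ≢ 0
  count≢0 e = ℕ.<⇒≢ 1≤λ′ (trans (sym e) (countRows-symbolic oa (proj₁ (proj₂ c-cover)) (λ _ → u , refl)))

atColumn : ∀ {r} → Fin r → (ℚ → ℚ) → Fin r → ℚ → ℚ
atColumn j σ j′ = if does (j′ Fin.≟ j) then σ else id

atColumn-closed : ∀ {r} (P : (ℚ → ℚ) → Set) (j : Fin r) {σ} → P σ → P id → ∀ j′ → P (atColumn j σ j′)
atColumn-closed P j Pσ Pid j′ with j′ Fin.≟ j
... | yes _ = Pσ
... | no _  = Pid

atColumn-≡ : ∀ {r} (j : Fin r) σ x → atColumn j σ j x ≡ σ x
atColumn-≡ j σ x = cong (λ β → (if β then σ else id) x) (dec-true (j Fin.≟ j) refl)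

atColumn-≢ : ∀ {r} {j j′ : Fin r} σ x → j′ ≢ j → atColumn j σ j′ x ≡ x
atColumn-≢ {j = j} {j′} σ x j′≢j = cong (λ β → (if β then σ else id) x) (dec-false (j′ Fin.≟ j) j′≢j)

swap : ℚ → ℚ → ℚ → ℚ
swap a b x = if does (x ≟ a) then b else if does (x ≟ b) then a else x

swap-closed : ∀ (P : ℚ → Set) {a b} → P a → P b → ∀ x → P x → P (swap a b x)
swap-closed P {a} {b} Pa Pb x Px with x ≟ a | x ≟ b
... | yes _ | _     = Pb
... | no _  | yes _ = Pa
... | no _  | no _  = Px

swap-left : ∀ a b → swap a b a ≡ b
swap-left a b with a ≟ a
... | yes _   = refl
... | no a≢a = contradiction refl a≢a

swap-right : ∀ a b → swap a b b ≡ a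
swap-right a b with b ≟ a | b ≟ b
... | yes b≡a | _       = b≡a
... | no _    | yes _   = refl
... | no _    | no b≢b = contradiction refl b≢b

swap-other : ∀ {a b x} → x ≢ a → x ≢ b → swap a b x ≡ x
swap-other {a} {b} {x} x≢a x≢b with x ≟ a | x ≟ b
... | yes x≡a | _       = contradiction x≡a x≢a
... | no _    | yes x≡b = contradiction x≡b x≢b
... | no _    | no _    = refl

swap-involutive : ∀ a b → Involutive (swap a b)
swap-involutive a b x with a ≟ x | b ≟ x
... | yes refl | _        = trans (cong (swap a b) (swap-left a b)) (swap-right a b)
... | no _     | yes refl = trans (cong (swap a b) (swap-right a b)) (swap-left a b)
... | no a≢x   | no b≢x   = trans (cong (swap a b) x-fixed) x-fixed
  where x-fixed = swap-other (a≢x ∘ sym) (b≢x ∘ sym)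

swap≡left⇔≡right : ∀ a b x → swap a b x ≡ a ⇔ x ≡ b
swap≡left⇔≡right a b x = mk⇔
  (λ e → trans (sym (swap-involutive a b x)) (trans (cong (swap a b) e) (swap-left a b)))
  (λ e → trans (cong (swap a b) e) (swap-right a b))

IsOA-mapColumns : ∀ {ℓ r s t λ′} {S : Fin s → ℚ} {X : Array ℓ r} (ρ : Fin r → ℚ → ℚ) →
  (∀ j → Involutive (ρ j)) → (∀ j u → ∃ λ u′ → ρ j (S u) ≡ S u′) →
  IsOA ℓ r s t λ′ S X → IsOA ℓ r s t λ′ S (λ i j → ρ j (X i j))
IsOA-mapColumns {S = S} {X} ρ ρ-inv ρ-sym oa = record
  { symbolsDistinct = symbolsDistinct
  ; t≤r = t≤r
  ; entriesSymbols = λ i j → let (u , e) = entriesSymbols i j ; (u′ , e′) = ρ-sym j u in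
                             u′ , trans (cong (ρ j) e) e′
  ; balanced = λ c c-inj u → trans (countRows-cong (same-rows c u))
                                   (countRows-symbolic oa c-inj (λ m → ρ-sym (c m) (u m)))
  }
  where
  open IsOA oa
  same-rows : ∀ {t} (c : Fin t → _) u i →
    Matches (λ j → ρ j (X i j)) c (S ∘ u) ⇔ Matches (X i) c (λ m → ρ (c m) (S (u m)))
  same-rows c u i = mk⇔
    (λ h m → trans (sym (ρ-inv (c m) (X i (c m)))) (cong (ρ (c m)) (h m)))
    (λ h m → trans (cong (ρ (c m)) (h m)) (ρ-inv (c m) (S (u m))))

combination : ∀ {ℓ r} → (Fin ℓ → ℚ) → Array ℓ r → Fin r → ℚ
combination w X j = sumℚ (λ i → w i * X i j)

infix 7 _·_
_·_ : ∀ {r} → (Fin r → ℚ) → (Fin r → ℚ) → ℚ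
γ · a = sumℚ (λ j → γ j * a j)

·-combination : ∀ {ℓ r} (γ : Fin r → ℚ) (w : Fin ℓ → ℚ) (X : Array ℓ r) →
  γ · combination w X ≡ sumℚ (λ i → w i * (γ · X i))
·-combination γ w X = begin
  sumℚ (λ j → γ j * sumℚ (λ i → w i * X i j))
    ≡⟨ sumℚ-cong (λ j → *-distribˡ-sumℚ (γ j) (λ i → w i * X i j)) ⟩
  sumℚ (λ j → sumℚ (λ i → γ j * (w i * X i j)))
    ≡⟨ sumℚ-comm (λ j i → γ j * (w i * X i j)) ⟩
  sumℚ (λ i → sumℚ (λ j → γ j * (w i * X i j)))
    ≡⟨ sumℚ-cong (λ i → sumℚ-cong (λ j → *-left-comm (γ j) (w i) (X i j))) ⟩
  sumℚ (λ i → sumℚ (λ j → w i * (γ j * X i j)))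
    ≡⟨ sumℚ-cong (λ i → *-distribˡ-sumℚ (w i) (λ j → γ j * X i j)) ⟨
  sumℚ (λ i → w i * (γ · X i))                     ∎
  where open ≡-Reasoning

·-combination-≡0 : ∀ {ℓ r} (γ : Fin r → ℚ) (X : Array ℓ r) → (∀ i → γ · X i ≡ 0ℚ) →
  ∀ w → γ · combination w X ≡ 0ℚ
·-combination-≡0 {ℓ} γ X γ⊥X w = begin
  γ · combination w X              ≡⟨ ·-combination γ w X ⟩
  sumℚ (λ i → w i * (γ · X i))     ≡⟨ sumℚ-cong (λ i → trans (cong (w i *_) (γ⊥X i)) (ℚ.*-zeroʳ (w i))) ⟩
  sumℚ {ℓ} (λ _ → 0ℚ)              ≡⟨ sumℚ-zero ℓ ⟩
  0ℚ                               ∎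
  where open ≡-Reasoning

·-agree-except : ∀ {r} (γ a b : Fin r → ℚ) j → (∀ j′ → j′ ≢ j → a j′ ≡ b j′) →
  γ · a ≡ γ · b → γ j * a j ≡ γ j * b j
·-agree-except {suc r} γ a b j a≈b γa≡γb = +-cancelʳ rest (γ j * a j) (γ j * b j) (begin
  γ j * a j ℚ.+ rest                                       ≡⟨ sumℚ-remove (λ j′ → γ j′ * a j′) j ⟨
  γ · a                                                    ≡⟨ γa≡γb ⟩
  γ · b                                                    ≡⟨ sumℚ-remove (λ j′ → γ j′ * b j′) j ⟩
  γ j * b j ℚ.+ sumℚ (removeAt (λ j′ → γ j′ * b j′) j)     ≡⟨ cong (γ j * b j ℚ.+_) (sumℚ-cong rests-agree) ⟨
  γ j * b j ℚ.+ rest                                       ∎)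
  where
  open ≡-Reasoning
  rest = sumℚ (removeAt (λ j′ → γ j′ * a j′) j)
  rests-agree : ∀ i → γ (punchIn j i) * a (punchIn j i) ≡ γ (punchIn j i) * b (punchIn j i)
  rests-agree i = cong (γ (punchIn j i) *_) (a≈b (punchIn j i) (punchInᵢ≢i j i))

module _ {ℓ r} (X : Array ℓ r) (j : Fin r) where

  withSymbol : ℚ → Fin ℓ → ℚ
  withSymbol y i = 𝟙ℚ (X i j ≟ y)

  frequency : ℚ → ℚ
  frequency y = sumℚ (withSymbol y)

  combination-withSymbol-at : ∀ y → combination (withSymbol y) X j ≡ y * frequency y
  combination-withSymbol-at y = trans (sumℚ-cong weighted-entry) (sym (*-distribˡ-sumℚ y (withSymbol y)))
    where
    weighted-entry : ∀ i → withSymbol y i * X i j ≡ y * withSymbol y i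
    weighted-entry i with X i j ≟ y
    ... | yes Xij≡y = trans (ℚ.*-identityˡ (X i j)) (trans Xij≡y (sym (ℚ.*-identityʳ y)))
    ... | no _      = trans (ℚ.*-zeroˡ (X i j)) (sym (ℚ.*-zeroʳ y))

module _ {ℓ r s t λ′} {S : Fin s → ℚ} {X : Array ℓ r} (oa : IsOA ℓ r s t λ′ S X) (j : Fin r) where

  frequency-pos : 1 ≤ t → 1 ≤ λ′ → ∀ u → 0ℚ < frequency X j (S u)
  frequency-pos 1≤t 1≤λ′ u =
    let (i , Xij≡Su) = OA-symbol-occurs oa 1≤t 1≤λ′ j u in
    sumℚ-pos (withSymbol X j (S u)) (λ i → 𝟙ℚ-nonneg (X i j ≟ S u)) i
      (subst (0ℚ <_) (sym (𝟙ℚ-true (X i j ≟ S u) Xij≡Su)) (ℚ.positive⁻¹ 1ℚ))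

  module _ (2≤t : 2 ≤ t) (u₁ u₂ : Fin s) where
    private
      a b : ℚ
      a = S u₁
      b = S u₂
      X′ : Array ℓ r
      X′ i j′ = atColumn j (swap a b) j′ (X i j′)
      Symbol : ℚ → Set
      Symbol x = ∃ λ u → x ≡ S u
      oa′ : IsOA ℓ r s t λ′ S X′
      oa′ = IsOA-mapColumns (atColumn j (swap a b))
        (atColumn-closed Involutive j (swap-involutive a b) (λ _ → refl))
        (λ j′ u → atColumn-closed (λ σ → Symbol (σ (S u))) j
                    (swap-closed Symbol (u₁ , refl) (u₂ , refl) (S u) (u , refl)) (u , refl) j′)
        oa
      withSymbol-swap : ∀ i → 𝟙ℚ (X′ i j ≟ a) ≡ withSymbol X j b i
      withSymbol-swap i = trans (cong (λ x → 𝟙ℚ (x ≟ a)) (atColumn-≡ j (swap a b) (X i j)))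
                                (𝟙ℚ-⇔ (swap≡left⇔≡right a b (X i j)) (swap a b (X i j) ≟ a) (X i j ≟ b))

    frequency-swap : frequency X j a ≡ frequency X j b
    frequency-swap = trans
      (sumℚ-OA-invariant₂ oa oa′ 2≤t j j {λ x → 𝟙ℚ (x j ≟ a)} (λ e _ → cong (λ x → 𝟙ℚ (x ≟ a)) e))
      (sumℚ-cong withSymbol-swap)

    combination-withSymbol-swap : ∀ j′ → j′ ≢ j →
      combination (withSymbol X j a) X j′ ≡ combination (withSymbol X j b) X j′
    combination-withSymbol-swap j′ j′≢j = trans
      (sumℚ-OA-invariant₂ oa oa′ 2≤t j j′ {λ x → 𝟙ℚ (x j ≟ a) * x j′}
        (λ e e′ → cong₂ (λ x y → 𝟙ℚ (x ≟ a) * y) e e′))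
      (sumℚ-cong (λ i → cong₂ _*_ (withSymbol-swap i) (atColumn-≢ (swap a b) (X i j′) j′≢j)))

OA-hasRank : ∀ {ℓ r s t λ′} {S : Fin s → ℚ} {X : Array ℓ r} →
  2 ≤ s → 2 ≤ t → 1 ≤ λ′ → IsOA ℓ r s t λ′ S X → HasRank X
OA-hasRank {S = S} {X} (s≤s (s≤s _)) 2≤t 1≤λ′ oa γ γ⊥X j with γ j ≟ 0ℚ
... | yes γj≡0 = γj≡0
... | no γj≢0 = contradiction (IsOA.symbolsDistinct oa a≡b) λ ()
  where
  open ≡-Reasoning
  a = S zero
  b = S (suc zero)
  N = frequency X j a
  N≢0 : N ≢ 0ℚ
  N≢0 N≡0 = ℚ.<-irrefl (sym N≡0) (frequency-pos oa j (ℕ.<⇒≤ 2≤t) 1≤λ′ zero)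
  N≡frequency-b : N ≡ frequency X j b
  N≡frequency-b = frequency-swap oa j 2≤t zero (suc zero)
  γ⊥rowsWith : ∀ y → γ · combination (withSymbol X j y) X ≡ 0ℚ
  γ⊥rowsWith y = ·-combination-≡0 γ X γ⊥X (withSymbol X j y)
  γj-equation : γ j * (a * N) ≡ γ j * (b * N)
  γj-equation = begin
    γ j * (a * N)                               ≡⟨ cong (γ j *_) (combination-withSymbol-at X j a) ⟨
    γ j * combination (withSymbol X j a) X j    ≡⟨ ·-agree-except γ _ _ j
                                                     (combination-withSymbol-swap oa j 2≤t zero (suc zero))
                                                     (trans (γ⊥rowsWith a) (sym (γ⊥rowsWith b))) ⟩
    γ j * combination (withSymbol X j b) X j    ≡⟨ cong (γ j *_) (combination-withSymbol-at X j b) ⟩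
    γ j * (b * frequency X j b)                 ≡⟨ cong (λ n → γ j * (b * n)) N≡frequency-b ⟨
    γ j * (b * N)                               ∎
  a≡b : a ≡ b
  a≡b = *-almostCancelˡ N a b N≢0
    (trans (ℚ.*-comm N a) (trans (*-almostCancelˡ (γ j) (a * N) (b * N) γj≢0 γj-equation) (ℚ.*-comm b N)))

theorem4p1 : (ℓ r s t λ′ : ℕ) → 2 ≤ s → 2 ≤ t → 1 ≤ λ′ →
    (S : Fin s → ℚ) → (X Y : Array ℓ r) →
    IsOA ℓ r s t λ′ S X → IsOA ℓ r s t λ′ S Y → Disjoint X Y →
    IsProperPTE t X Y
theorem4p1 ℓ r s t λ′ 2≤s 2≤t 1≤λ′ S X Y oaX oaY disjoint =
  (disjoint , λ k _ Σk≤t → OA-moments oaX oaY k Σk≤t) ,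
  OA-hasRank 2≤s 2≤t 1≤λ′ oaX ,
  OA-hasRank 2≤s 2≤t 1≤λ′ oaY
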